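{- For any two positive integers $d$ and $n$, $n < R(d+1, \nu_d(n)+1)$.
   Context: All graphs are finite, simple and undirected; $A_G$ is the adjacency matrix, $I$ the identity matrix, rank over $\mathbb{R}$, $\omega(G)$ the clique number. $\nu_d(n)$ is the minimum of $\operatorname{rank}(A_G+I)$ over all $n$-vertex graphs $G$ with $\omega(G)\le d$. $R(s,t)$ is the classical Ramsey number: the least $N$ such that every graph on $N$ vertices has a clique of size $s$ or an independent set of size $t$. -}

module Defs where

open import Data.Nat using (ℕ; zero; suc; _≤_; _<_)
open import Data.Fin using (Fin; zero; suc)
open import Data.Bool using (Bool; true; false)
open import Data.Rational using (ℚ; 0ℚ; 1ℚ; _+_; _*_)
open import Data.Product using (Σ; ∃; _×_; _,_)
open import Data.Sum using (_⊎_)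
open import Relation.Binary.PropositionalEquality using (_≡_; _≢_)
open import Relation.Nullary using (¬_)
open import Function.Definitions using (Injective)

record Graph (n : ℕ) : Set where
  field
    adj   : Fin n → Fin n → Bool
    sym   : ∀ i j → adj i j ≡ adj j i
    irrefl : ∀ i → adj i i ≡ false
open Graph public

HasClique : ∀ {n} → Graph n → ℕ → Set
HasClique {n} G k = Σ (Fin k → Fin n) λ f →
  Injective _≡_ _≡_ f × (∀ i j → i ≢ j → adj G (f i) (f j) ≡ true)

HasIndep : ∀ {n} → Graph n → ℕ → Set
HasIndep {n} G k = Σ (Fin k → Fin n) λ f →
  Injective _≡_ _≡_ f × (∀ i j → i ≢ j → adj G (f i) (f j) ≡ false)

CliqueNumberAtMost : ∀ {n} → Graph n → ℕ → Set
CliqueNumberAtMost G d = ¬ HasClique G (suc d)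

Matrix : ℕ → ℕ → Set
Matrix m n = Fin m → Fin n → ℚ

sumFin : ∀ {k} → (Fin k → ℚ) → ℚ
sumFin {zero}  f = 0ℚ
sumFin {suc k} f = f zero + sumFin (λ i → f (suc i))

LinIndepCols : ∀ {m n k} → Matrix m n → (Fin k → Fin n) → Set
LinIndepCols {m} {n} {k} M cols =
  Injective _≡_ _≡_ cols ×
  (∀ (c : Fin k → ℚ) → (∀ i → sumFin (λ j → c j * M i (cols j)) ≡ 0ℚ) → ∀ j → c j ≡ 0ℚ)

HasRank : ∀ {m n} → Matrix m n → ℕ → Set
HasRank {m} {n} M r =
  (Σ (Fin r → Fin n) λ cols → LinIndepCols M cols) ×
  (∀ k (cols : Fin k → Fin n) → LinIndepCols M cols → k ≤ r)

AdjPlusI : ∀ {n} → Graph n → Matrix n n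
AdjPlusI G i j with adj G i j
... | true  = 1ℚ
... | false with i Data.Fin.≟ j
...   | Relation.Nullary.yes _ = 1ℚ
...   | Relation.Nullary.no  _ = 0ℚ

-- ν_d(n) = m : m is the minimum of rank(A_G + I) over n-vertex graphs G with ω(G) ≤ d.
IsNu : ℕ → ℕ → ℕ → Set
IsNu d n m =
  (Σ (Graph n) λ G → CliqueNumberAtMost G d × HasRank (AdjPlusI G) m) ×
  (∀ (G : Graph n) r → CliqueNumberAtMost G d → HasRank (AdjPlusI G) r → m ≤ r)

RamseyProp : ℕ → ℕ → ℕ → Set
RamseyProp s t N = ∀ (G : Graph N) → HasClique G s ⊎ HasIndep G t

IsRamsey : ℕ → ℕ → ℕ → Set
IsRamsey s t N = RamseyProp s t N × (∀ N′ → N′ < N → ¬ RamseyProp s t N′)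

{-# OPTIONS --safe #-}
-- An independent set S of G indexes an identity submatrix of A_G + I, so its columns are
-- linearly independent and |S| ≤ rank (A_G + I).  If R(d+1, ν_d(n)+1) ≤ n, take G on n
-- vertices with ω(G) ≤ d and rank (A_G + I) = ν_d(n): it has no (d+1)-clique, so by the
-- Ramsey property it has an independent set of size ν_d(n) + 1, which is impossible.
module Submission where

open import Defs hiding (sym)
open import Data.Nat using (ℕ; zero; suc; _≤_; _<_)
open import Data.Nat.Properties using (≰⇒>; n≮n)
open import Data.Fin using (Fin; zero; suc; inject≤; _≟_)
open import Data.Fin.Properties using (inject≤-injective; suc-injective)
open import Data.Bool using (false)
open import Data.Rational using (ℚ; 0ℚ; 1ℚ; _+_; _*_)
open import Data.Rational.Properties using (+-identityˡ; +-identityʳ; *-identityʳ; *-zeroʳ)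
open import Data.Product using (_,_)
open import Data.Sum using ([_,_]; map)
open import Function using (_∘_)
open import Function.Definitions using (Injective)
open import Function.Construct.Composition using (injective)
open import Relation.Nullary using (contradiction; yes; no)
open import Relation.Binary.PropositionalEquality
  using (_≡_; _≢_; refl; sym; cong; cong₂; module ≡-Reasoning)

induce : ∀ {k n} → (Fin k → Fin n) → Graph n → Graph k
induce e G = record
  { adj    = λ i j → adj G (e i) (e j)
  ; sym    = λ i j → Graph.sym G (e i) (e j)
  ; irrefl = λ i → irrefl G (e i)
  }

module _ {k n} {e : Fin k → Fin n} (e-injective : Injective _≡_ _≡_ e) (G : Graph n) where

  HasClique-induce : ∀ {s} → HasClique (induce e G) s → HasClique G s
  HasClique-induce (f , f-injective , clique) =
    e ∘ f , injective _≡_ _≡_ _≡_ f-injective e-injective , clique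

  HasIndep-induce : ∀ {t} → HasIndep (induce e G) t → HasIndep G t
  HasIndep-induce (f , f-injective , indep) =
    e ∘ f , injective _≡_ _≡_ _≡_ f-injective e-injective , indep

RamseyProp-mono : ∀ {s t N n} → N ≤ n → RamseyProp s t N → RamseyProp s t n
RamseyProp-mono N≤n ramsey G =
  map (HasClique-induce e-injective G) (HasIndep-induce e-injective G) (ramsey (induce e G))
  where
  e : Fin _ → Fin _
  e i = inject≤ i N≤n

  e-injective : Injective _≡_ _≡_ e
  e-injective {i} {j} = inject≤-injective N≤n N≤n i j

sumFin-zero : ∀ {k} (f : Fin k → ℚ) → (∀ j → f j ≡ 0ℚ) → sumFin f ≡ 0ℚ
sumFin-zero {zero}  f f≡0 = refl
sumFin-zero {suc k} f f≡0 = begin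
  f zero + sumFin (f ∘ suc) ≡⟨ cong₂ _+_ (f≡0 zero) (sumFin-zero (f ∘ suc) (f≡0 ∘ suc)) ⟩
  0ℚ + 0ℚ                   ≡⟨ +-identityʳ 0ℚ ⟩
  0ℚ                        ∎
  where open ≡-Reasoning

sumFin-single : ∀ {k} (f : Fin k → ℚ) j₀ → (∀ j → j ≢ j₀ → f j ≡ 0ℚ) → sumFin f ≡ f j₀
sumFin-single {suc k} f zero f≡0 = begin
  f zero + sumFin (f ∘ suc) ≡⟨ cong (f zero +_) (sumFin-zero (f ∘ suc) (λ j → f≡0 (suc j) λ ())) ⟩
  f zero + 0ℚ               ≡⟨ +-identityʳ (f zero) ⟩
  f zero                    ∎
  where open ≡-Reasoning
sumFin-single {suc k} f (suc j₀) f≡0 = begin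
  f zero + sumFin (f ∘ suc) ≡⟨ cong (_+ sumFin (f ∘ suc)) (f≡0 zero λ ()) ⟩
  0ℚ + sumFin (f ∘ suc)     ≡⟨ +-identityˡ _ ⟩
  sumFin (f ∘ suc)          ≡⟨ sumFin-single (f ∘ suc) j₀ (λ j j≢j₀ → f≡0 (suc j) (j≢j₀ ∘ suc-injective)) ⟩
  f (suc j₀)                ∎
  where open ≡-Reasoning

AdjPlusI-diagonal : ∀ {n} (G : Graph n) i → AdjPlusI G i i ≡ 1ℚ
AdjPlusI-diagonal G i with adj G i i | irrefl G i
... | false | _ with i ≟ i
...   | yes _   = refl
...   | no i≢i  = contradiction refl i≢i

AdjPlusI-nonadjacent : ∀ {n} (G : Graph n) i j → adj G i j ≡ false → i ≢ j → AdjPlusI G i j ≡ 0ℚ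
AdjPlusI-nonadjacent G i j i≁j i≢j with adj G i j
AdjPlusI-nonadjacent G i j refl i≢j | false with i ≟ j
... | yes i≡j = contradiction i≡j i≢j
... | no _    = refl

indep⇒LinIndepCols : ∀ {n k} (G : Graph n) (f : Fin k → Fin n) → Injective _≡_ _≡_ f →
                     (∀ i j → i ≢ j → adj G (f i) (f j) ≡ false) → LinIndepCols (AdjPlusI G) f
indep⇒LinIndepCols G f f-injective indep = f-injective , coefficients-vanish
  where
  M = AdjPlusI G

  off-diagonal : ∀ j₀ j → j ≢ j₀ → M (f j₀) (f j) ≡ 0ℚ
  off-diagonal j₀ j j≢j₀ =
    AdjPlusI-nonadjacent G (f j₀) (f j) (indep j₀ j (j≢j₀ ∘ sym)) (j≢j₀ ∘ sym ∘ f-injective)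

  coefficients-vanish : ∀ c → (∀ i → sumFin (λ j → c j * M i (f j)) ≡ 0ℚ) → ∀ j₀ → c j₀ ≡ 0ℚ
  coefficients-vanish c combination≡0 j₀ = begin
    c j₀                                ≡⟨ sym (*-identityʳ (c j₀)) ⟩
    c j₀ * 1ℚ                           ≡⟨ cong (c j₀ *_) (sym (AdjPlusI-diagonal G (f j₀))) ⟩
    c j₀ * M (f j₀) (f j₀)              ≡⟨ sym (sumFin-single _ j₀ row-vanishes) ⟩
    sumFin (λ j → c j * M (f j₀) (f j)) ≡⟨ combination≡0 (f j₀) ⟩
    0ℚ                                  ∎
    where
    open ≡-Reasoning
    row-vanishes : ∀ j → j ≢ j₀ → c j * M (f j₀) (f j) ≡ 0ℚ
    row-vanishes j j≢j₀ = begin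
      c j * M (f j₀) (f j) ≡⟨ cong (c j *_) (off-diagonal j₀ j j≢j₀) ⟩
      c j * 0ℚ             ≡⟨ *-zeroʳ (c j) ⟩
      0ℚ                   ∎

HasIndep⇒≤rank : ∀ {n t r} (G : Graph n) → HasRank (AdjPlusI G) r → HasIndep G t → t ≤ r
HasIndep⇒≤rank G (_ , maximal) (f , f-injective , indep) =
  maximal _ f (indep⇒LinIndepCols G f f-injective indep)

proposition2p9 : ∀ (d n : ℕ) → 1 ≤ d → 1 ≤ n →
    ∀ (m : ℕ) → IsNu d n m →
    ∀ (N : ℕ) → IsRamsey (suc d) (suc m) N →
    n < N
proposition2p9 d n _ _ m ((G , ω≤d , rank≡m) , _) N (ramsey , _) = ≰⇒> λ N≤n →
  [ ω≤d , n≮n m ∘ HasIndep⇒≤rank G rank≡m ] (RamseyProp-mono N≤n ramsey G)
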